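{- Let $a,b$ be distinct nonadjacent vertices of the Shrikhande graph, and let $u(a,b)$, $w(a,b)$ be their two common neighbours. If the element $a-b\in\mathbb{Z}_4^2$ has order $2$, then $u(a,b)$ and $w(a,b)$ are nonadjacent; if $a-b$ has order $4$, then $u(a,b)$ and $w(a,b)$ are adjacent.
   Context: The Shrikhande graph $\mathrm{Sh}$ is the Cayley graph on the group $\mathbb{Z}_4^2$ (elements written $ab$ with $a,b\in\mathbb{Z}_4$) with connection set $\{01,03,10,30,11,33\}$: vertices $x,y$ are adjacent iff $x-y$ lies in this set. Any two distinct vertices of $\mathrm{Sh}$ have exactly two common neighbours, denoted $u(a,b)$ and $w(a,b)$. -}

module Defs where

open import Data.Nat using (ℕ; zero; suc; _<_; _≤_; _%_)
open import Data.Nat.DivMod using (m%n<n)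
open import Data.Fin using (Fin; toℕ; fromℕ<)
open import Data.Product using (_×_; _,_)
open import Data.Sum using (_⊎_)
open import Relation.Binary.PropositionalEquality using (_≡_)
open import Relation.Nullary using (¬_)

Z4 : Set
Z4 = Fin 4

mod4 : ℕ → Z4
mod4 n = fromℕ< (m%n<n n 4)

_+₄_ : Z4 → Z4 → Z4
x +₄ y = mod4 (toℕ x Data.Nat.+ toℕ y)

-₄_ : Z4 → Z4
-₄ x = mod4 (4 Data.Nat.∸ toℕ x)

-- The group ℤ₄²; the element written ab is (a , b).
V : Set
V = Z4 × Z4

_+V_ : V → V → V
(a , b) +V (c , d) = (a +₄ c , b +₄ d)

-V_ : V → V
-V (a , b) = (-₄ a , -₄ b)

_-V_ : V → V → V
x -V y = x +V (-V y)

0V : V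
0V = (mod4 0 , mod4 0)

_·V_ : ℕ → V → V
zero  ·V x = 0V
suc k ·V x = x +V (k ·V x)

HasOrder : V → ℕ → Set
HasOrder x k = (1 ≤ k) × (k ·V x ≡ 0V) × (∀ j → 1 ≤ j → j < k → ¬ (j ·V x ≡ 0V))

InConn : V → Set
InConn x = (x ≡ (mod4 0 , mod4 1)) ⊎ (x ≡ (mod4 0 , mod4 3)) ⊎ (x ≡ (mod4 1 , mod4 0))
         ⊎ (x ≡ (mod4 3 , mod4 0)) ⊎ (x ≡ (mod4 1 , mod4 1)) ⊎ (x ≡ (mod4 3 , mod4 3))

-- adjacency in the Shrikhande graph (Cayley graph on ℤ₄² with the above connection set)
Adj : V → V → Set
Adj x y = InConn (x -V y)

CommonNbr : V → V → V → Set
CommonNbr a b c = Adj a c × Adj b c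

-- Everything is translation invariant, so we measure vertices
-- relative to a.  A vertex c is a common neighbour of a and b exactly
-- when s = a − c lies in S and so does s − d, where d = a − b; call such
-- an s a route of d.  For two common neighbours u, w with routes
-- s = a − u and t = a − w we have u − w = t − s, so whether u ∼ w depends
-- only on d and its two routes.  The theorem thus reduces to a statement
-- about the 16 elements d of ℤ₄² and the routes of each (routes-lemma):
-- for d ∉ S ∪ {0} two distinct routes differ by an element of S iff
-- 2d ≠ 0.  This is a finite fact which we verify by evaluation.
module Submission where

open import Defs
open import Algebra.Bundles using (AbelianGroup)
open import Algebra.Structures using (IsAbelianGroup)
import Algebra.Properties.AbelianGroup as AbelianGroupProperties
open import Data.Fin.Properties using (all?) renaming (_≟_ to _≟₄_)
open import Data.Nat using (s≤s; z≤n)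
open import Data.Product using (_×_; _,_; proj₁; proj₂)
open import Data.Product.Properties using (≡-dec; ,-injectiveˡ; ,-injectiveʳ)
open import Relation.Binary.PropositionalEquality
  using (_≡_; sym; cong; cong₂; subst; isEquivalence; module ≡-Reasoning)
open import Relation.Binary.Definitions using (DecidableEquality)
open import Relation.Nullary using (¬_; Dec)
open import Relation.Nullary.Decidable
  using (from-yes; map′; ¬?; _⊎-dec_; _×-dec_; _→-dec_)

+₄-assoc : ∀ x y z → (x +₄ y) +₄ z ≡ x +₄ (y +₄ z)
+₄-assoc = from-yes (all? λ x → all? λ y → all? λ z → (x +₄ y) +₄ z ≟₄ x +₄ (y +₄ z))

+₄-comm : ∀ x y → x +₄ y ≡ y +₄ x
+₄-comm = from-yes (all? λ x → all? λ y → x +₄ y ≟₄ y +₄ x)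

+₄-identityˡ : ∀ x → mod4 0 +₄ x ≡ x
+₄-identityˡ = from-yes (all? λ x → mod4 0 +₄ x ≟₄ x)

+₄-identityʳ : ∀ x → x +₄ mod4 0 ≡ x
+₄-identityʳ = from-yes (all? λ x → x +₄ mod4 0 ≟₄ x)

+₄-inverseˡ : ∀ x → (-₄ x) +₄ x ≡ mod4 0
+₄-inverseˡ = from-yes (all? λ x → (-₄ x) +₄ x ≟₄ mod4 0)

+₄-inverseʳ : ∀ x → x +₄ (-₄ x) ≡ mod4 0
+₄-inverseʳ = from-yes (all? λ x → x +₄ (-₄ x) ≟₄ mod4 0)

ℤ₄-isAbelianGroup : IsAbelianGroup _≡_ _+₄_ (mod4 0) -₄_
ℤ₄-isAbelianGroup = record
  { isGroup = record
    { isMonoid = record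
      { isSemigroup = record
        { isMagma = record { isEquivalence = isEquivalence ; ∙-cong = cong₂ _+₄_ }
        ; assoc = +₄-assoc
        }
      ; identity = +₄-identityˡ , +₄-identityʳ
      }
    ; inverse = +₄-inverseˡ , +₄-inverseʳ
    ; ⁻¹-cong = cong -₄_
    }
  ; comm = +₄-comm
  }

ℤ₄-abelianGroup : AbelianGroup _ _
ℤ₄-abelianGroup = record { isAbelianGroup = ℤ₄-isAbelianGroup }

module _ {g ℓ} (G : AbelianGroup g ℓ) where
  open AbelianGroup G
  open AbelianGroupProperties G using (⁻¹-anti-homo‿-; \\-leftDividesʳ)
  open import Relation.Binary.Reasoning.Setoid setoid

  difference-from-base : ∀ x y z → (x - z) - (x - y) ≈ y - z
  difference-from-base x y z = begin
    (x - z) - (x - y)          ≈⟨ ∙-congˡ (⁻¹-anti-homo‿- x y) ⟩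
    (x - z) ∙ (y - x)          ≈⟨ comm (x - z) (y - x) ⟩
    (y - x) ∙ (x - z)          ≈⟨ assoc y (x ⁻¹) (x - z) ⟩
    y ∙ (x ⁻¹ ∙ (x ∙ z ⁻¹))    ≈⟨ ∙-congˡ (\\-leftDividesʳ x (z ⁻¹)) ⟩
    y - z                      ∎

module ℤ₄ = AbelianGroup ℤ₄-abelianGroup
open AbelianGroupProperties ℤ₄-abelianGroup using (x∙y⁻¹≈ε⇒x≈y)

-V-from-base : ∀ x y z → y -V z ≡ (x -V z) -V (x -V y)
-V-from-base (x₁ , x₂) (y₁ , y₂) (z₁ , z₂) =
  cong₂ _,_ (ℤ₄.sym (difference-from-base ℤ₄-abelianGroup x₁ y₁ z₁))
            (ℤ₄.sym (difference-from-base ℤ₄-abelianGroup x₂ y₂ z₂))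

-V-cancel : ∀ {x y} → x -V y ≡ 0V → x ≡ y
-V-cancel {x₁ , x₂} {y₁ , y₂} x-y≡0 =
  cong₂ _,_ (x∙y⁻¹≈ε⇒x≈y x₁ y₁ (,-injectiveˡ x-y≡0))
            (x∙y⁻¹≈ε⇒x≈y x₂ y₂ (,-injectiveʳ x-y≡0))

-V-self : ∀ x → x -V x ≡ 0V
-V-self (x₁ , x₂) = cong₂ _,_ (+₄-inverseʳ x₁) (+₄-inverseʳ x₂)

-V-injectiveʳ : ∀ {a u w} → a -V u ≡ a -V w → u ≡ w
-V-injectiveʳ {a} {u} {w} a-u≡a-w = -V-cancel (begin
  u -V w                    ≡⟨ -V-from-base a u w ⟩
  (a -V w) -V (a -V u)      ≡⟨ cong (λ v → (a -V w) -V v) a-u≡a-w ⟩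
  (a -V w) -V (a -V w)      ≡⟨ -V-self (a -V w) ⟩
  0V                        ∎)
  where open ≡-Reasoning

Route : V → V → Set
Route d s = InConn s × InConn (s -V d)

common-neighbour-route : ∀ a b c → CommonNbr a b c → Route (a -V b) (a -V c)
common-neighbour-route a b c (ac , bc) = ac , subst InConn (-V-from-base a b c) bc

infix 4 _≟V_
_≟V_ : DecidableEquality V
_≟V_ = ≡-dec _≟₄_ _≟₄_

inConn? : ∀ x → Dec (InConn x)
inConn? x = (x ≟V _) ⊎-dec (x ≟V _) ⊎-dec (x ≟V _)
          ⊎-dec (x ≟V _) ⊎-dec (x ≟V _) ⊎-dec (x ≟V _)

allV? : {P : V → Set} → (∀ x → Dec (P x)) → Dec (∀ x → P x)
allV? P? = map′ (λ p (x₁ , x₂) → p x₁ x₂) (λ p x₁ x₂ → p (x₁ , x₂))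
                (all? λ x₁ → all? λ x₂ → P? (x₁ , x₂))

RoutesLemma : V → V → V → Set
RoutesLemma d s t =
  ¬ d ≡ 0V → ¬ InConn d → Route d s → Route d t → ¬ s ≡ t
  → (2 ·V d ≡ 0V → ¬ InConn (t -V s)) × (¬ 2 ·V d ≡ 0V → InConn (t -V s))

routes-lemma : ∀ d s t → RoutesLemma d s t
routes-lemma = from-yes (allV? λ d → allV? λ s → allV? λ t →
    ¬? (d ≟V 0V) →-dec ¬? (inConn? d)
    →-dec (inConn? s ×-dec inConn? (s -V d))
    →-dec (inConn? t ×-dec inConn? (t -V d))
    →-dec ¬? (s ≟V t)
    →-dec ((2 ·V d ≟V 0V) →-dec ¬? (inConn? (t -V s)))
          ×-dec (¬? (2 ·V d ≟V 0V) →-dec inConn? (t -V s)))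

lemma1 : (a b u w : V) → ¬ (a ≡ b) → ¬ Adj a b
       → CommonNbr a b u → CommonNbr a b w → ¬ (u ≡ w)
       → (HasOrder (a -V b) 2 → ¬ Adj u w) × (HasOrder (a -V b) 4 → Adj u w)
lemma1 a b u w a≢b a≁b u-common w-common u≢w =
  (λ order2 u∼w → proj₁ routes (two-d≡0 order2) (subst InConn u-w≡t-s u∼w)) ,
  (λ order4 → subst InConn (sym u-w≡t-s) (proj₂ routes (two-d≢0 order4)))
  where
  d s t : V
  d = a -V b
  s = a -V u
  t = a -V w

  u-w≡t-s : u -V w ≡ t -V s
  u-w≡t-s = -V-from-base a u w

  routes : (2 ·V d ≡ 0V → ¬ InConn (t -V s)) × (¬ 2 ·V d ≡ 0V → InConn (t -V s))
  routes = routes-lemma d s t (λ d≡0 → a≢b (-V-cancel d≡0)) a≁b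
             (common-neighbour-route a b u u-common)
             (common-neighbour-route a b w w-common)
             (λ s≡t → u≢w (-V-injectiveʳ {a} s≡t))

  two-d≡0 : HasOrder d 2 → 2 ·V d ≡ 0V
  two-d≡0 (_ , 2d≡0 , _) = 2d≡0

  two-d≢0 : HasOrder d 4 → ¬ 2 ·V d ≡ 0V
  two-d≢0 (_ , _ , minimal) = minimal 2 (s≤s z≤n) (s≤s (s≤s (s≤s z≤n)))
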